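{- Let $\psi$ be an $\mathrm{FO}^3(<,\mathrm{succ},\mathrm{min},\mathrm{max})$-formula, $A,B$ sets of interpretations with $A\models\psi$ and $B\models\neg\psi$, and $\mathcal{T}=\mathcal{T}^{\langle A,B\rangle}_\psi$ an extended syntax tree. Let $v$ be a node of $\mathcal{T}$ with syntax label $sl(v)=Qu$ where $Q\in\{\exists,\forall\}$ and $u\in\{x,y,z\}$, let $v_1$ be its unique child, and let $\delta_1$ be a separator for $il(v_1)$. Define the potential separator $\tilde\delta$ by: $\tilde\delta(\{u,u'\})=0$ for all $u'\in\{\mathrm{min},\mathrm{max},x,y,z\}\setminus\{u\}$; $\tilde\delta(\{\mathrm{min},\mathrm{max}\})=\max\{\delta_1(\{\mathrm{min},\mathrm{max}\}),\ \delta_1(\{\mathrm{min},u\})+\delta_1(\{u,\mathrm{max}\})+1\}$; and for all $u',u''$ with $\{x,y,z\}=\{u,u',u''\}$ and all $m\in\{\mathrm{min},\mathrm{max}\}$: $\tilde\delta(\{u',u''\})=\max\{\delta_1(\{u',u''\}),\ \delta_1(\{u',u\})+\delta_1(\{u,u''\})+1\}$ and $\tilde\delta(\{m,u'\})=\max\{\delta_1(\{m,u'\}),\ \delta_1(\{m,u\})+\delta_1(\{u,u'\})+1\}$. Then $\tilde\delta$ is a separator for $il(v)$.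
   Context: Structures $\mathcal{A}_N$ ($N\in\mathbb{N}$): universe $\{0,\dots,N\}$, natural $<$, $\mathrm{succ}=\{(a,a+1)\}$, $\mathrm{min}=0$, $\mathrm{max}=N$. $\mathrm{FO}^3(<,\mathrm{succ},\mathrm{min},\mathrm{max})$: first-order formulas over this signature with variables $x,y,z$ only, built from atoms by $\neg,\vee,\wedge,\exists,\forall$. An interpretation is $(\mathcal{A},\alpha)$ with $\mathcal{A}=\mathcal{A}_N$ and $\alpha\colon\{x,y,z\}\to\{0,\dots,N\}$, extended by $\alpha(\mathrm{min})=0,\alpha(\mathrm{max})=N$; $\alpha[a/u]$ is $\alpha$ modified to map $u$ to $a$; $A\models\psi$ means every interpretation in $A$ satisfies $\psi$. $\mathrm{diff}(m,n)=m-n$; $<\!\text{ -type}(m,n)\in\{<,=,>\}$. A potential separator is $\delta\colon\mathcal{P}_2(\{\mathrm{min},\mathrm{max},x,y,z\})\to\mathbb{N}$ ($\mathcal{P}_2$ = 2-element subsets); it is a separator for $\langle A,B\rangle$ if for every $(\mathcal{A},\alpha)\in A$, $(\mathcal{B},\beta)\in B$ there are distinct $u,u'$ with $\delta(\{u,u'\})\ge1$ and either $<\!\text{ -type}(\alpha(u),\alpha(u'))\ne<\!\text{ -type}(\beta(u),\beta(u'))$, or [$\delta(\{u,u'\})\ge\min\{|\mathrm{diff}(\alpha(u),\alpha(u'))|,|\mathrm{diff}(\beta(u),\beta(u'))|\}$ and $\mathrm{diff}(\alpha(u),\alpha(u'))\ne\mathrm{diff}(\beta(u),\beta(u'))$].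 Extended syntax tree $\mathcal{T}^{\langle A,B\rangle}_\psi$, defined by induction on $\psi$; each node $v$ has syntax label $sl(v)$ and interpretation label $il(v)$, with the root labelled $il=\langle A,B\rangle$. Atomic $\psi$: single node, $sl=\psi$. $\psi=\neg\psi_1$: root with $sl=\neg$, child the root of $\mathcal{T}^{\langle B,A\rangle}_{\psi_1}$. $\psi=\psi_1\vee\psi_2$: root with $sl=\vee$, children the roots of $\mathcal{T}^{\langle A_i,B\rangle}_{\psi_i}$ with $A_i=\{I\in A:I\models\psi_i\}$. $\psi=\psi_1\wedge\psi_2$: root with $sl=\wedge$, children the roots of $\mathcal{T}^{\langle A,B_i\rangle}_{\psi_i}$ with $B_i=\{J\in B:J\not\models\psi_i\}$. $\psi=\exists u\,\psi_1$: root with $sl=\exists u$, child the root of $\mathcal{T}^{\langle A_1,B_1\rangle}_{\psi_1}$ with $B_1=\{(\mathcal{B},\beta[b/u]):(\mathcal{B},\beta)\in B, b$ in the universe of $\mathcal{B}\}$ and $A_1$ consisting of one $(\mathcal{A},\alpha[a/u])$ per $(\mathcal{A},\alpha)\in A$ for a fixed $a$ with $(\mathcal{A},\alpha[a/u])\models\psi_1$. $\psi=\forall u\,\psi_1$: dually, $A_1=\{(\mathcal{A},\alpha[a/u]):(\mathcal{A},\alpha)\in A, a$ in the universe$\}$ and $B_1$ consists of one $(\mathcal{B},\beta[b/u])$ per $(\mathcal{B},\beta)\in B$ for a fixed $b$ with $(\mathcal{B},\beta[b/u])\models\neg\psi_1$. -}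

module Defs where

open import Data.Nat using (ℕ; zero; suc; _+_; _≤_; _<_; _⊔_; _⊓_; _≤ᵇ_; _<ᵇ_; ∣_-_∣)
open import Data.Fin using (Fin; toℕ)
open import Data.Integer as ℤ using (ℤ; +_)
open import Data.Product using (Σ; _×_; _,_; proj₁; proj₂)
open import Data.Sum using (_⊎_)
open import Data.Bool using (Bool; true; false; if_then_else_)
open import Relation.Nullary using (¬_)
open import Relation.Binary.PropositionalEquality using (_≡_; _≢_)

data Var : Set where
  x y z : Var

data Term : Set where
  var  : Var → Term
  tmin tmax : Term

data Formula : Set where
  lessF : Term → Term → Formula
  succF : Term → Term → Formula
  eqF   : Term → Term → Formula
  negF  : Formula → Formula
  orF   : Formula → Formula → Formula
  andF  : Formula → Formula → Formula
  exF   : Var → Formula → Formula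
  allF  : Var → Formula → Formula

data Quant : Set where
  ∃Q ∀Q : Quant

quant : Quant → Var → Formula → Formula
quant ∃Q u φ = exF u φ
quant ∀Q u φ = allF u φ

-- Interpretations (𝒜_N, α), α : {x,y,z} → {0,…,N}

Interp : Set
Interp = Σ ℕ (λ N → Var → Fin (suc N))

eqVar : Var → Var → Bool
eqVar x x = true
eqVar y y = true
eqVar z z = true
eqVar _ _ = false

upd : (I : Interp) → Var → Fin (suc (proj₁ I)) → Interp
upd (N , α) u a = N , (λ w → if eqVar w u then a else α w)

val : Interp → Term → ℕ
val (N , α) (var w) = toℕ (α w)
val (N , α) tmin = 0
val (N , α) tmax = N

Sat : Interp → Formula → Set
Sat I (lessF t t') = val I t < val I t'
Sat I (succF t t') = suc (val I t) ≡ val I t'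
Sat I (eqF t t')   = val I t ≡ val I t'
Sat I (negF φ)     = ¬ Sat I φ
Sat I (orF φ ψ)    = Sat I φ ⊎ Sat I ψ
Sat I (andF φ ψ)   = Sat I φ × Sat I ψ
Sat I (exF u φ)    = Σ (Fin (suc (proj₁ I))) (λ a → Sat (upd I u a) φ)
Sat I (allF u φ)   = (a : Fin (suc (proj₁ I))) → Sat (upd I u a) φ

ISet : Set₁
ISet = Interp → Set

_⊨_ : ISet → Formula → Set
A ⊨ φ = (I : Interp) → A I → Sat I φ

-- The interpretation label of a node
-- is the pair of ISet indices; its syntax label is the head of the formula
-- index.  The choice of the witness a (resp. b) at ∃ (resp. ∀) nodes is a
-- function ch fixing one value per interpretation.

chosen : ISet → Var → ((I : Interp) → Fin (suc (proj₁ I))) → ISet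
chosen A u ch J = Σ Interp (λ I → A I × (J ≡ upd I u (ch I)))

allExt : ISet → Var → ISet
allExt A u J = Σ Interp (λ I → A I × Σ (Fin (suc (proj₁ I))) (λ a → J ≡ upd I u a))

data EST : ISet → ISet → Formula → Set₁ where
  estLess : ∀ {A B} t t' → EST A B (lessF t t')
  estSucc : ∀ {A B} t t' → EST A B (succF t t')
  estEq   : ∀ {A B} t t' → EST A B (eqF t t')
  estNeg  : ∀ {A B φ} → EST B A φ → EST A B (negF φ)
  estOr   : ∀ {A B φ₁ φ₂} →
            EST (λ I → A I × Sat I φ₁) B φ₁ →
            EST (λ I → A I × Sat I φ₂) B φ₂ →
            EST A B (orF φ₁ φ₂)
  estAnd  : ∀ {A B φ₁ φ₂} →
            EST A (λ J → B J × ¬ Sat J φ₁) φ₁ →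
            EST A (λ J → B J × ¬ Sat J φ₂) φ₂ →
            EST A B (andF φ₁ φ₂)
  estEx   : ∀ {A B u φ} (ch : (I : Interp) → Fin (suc (proj₁ I))) →
            ((I : Interp) → A I → Sat (upd I u (ch I)) φ) →
            EST (chosen A u ch) (allExt B u) φ →
            EST A B (exF u φ)
  estAll  : ∀ {A B u φ} (ch : (J : Interp) → Fin (suc (proj₁ J))) →
            ((J : Interp) → B J → Sat (upd J u (ch J)) (negF φ)) →
            EST (allExt A u) (chosen B u ch) φ →
            EST A B (allF u φ)

-- Sub S T : S is (the subtree rooted at) a node of T
data Sub {A' B' : ISet} {φ' : Formula} (S : EST A' B' φ') :
         {A B : ISet} {ψ : Formula} → EST A B ψ → Set₁ where
  here  : Sub S S
  inNeg : ∀ {A B φ} {T : EST B A φ} → Sub S T → Sub S (estNeg {A} {B} T)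
  inOrL : ∀ {A B φ₁ φ₂ T₁ T₂} → Sub S T₁ → Sub S (estOr {A} {B} {φ₁} {φ₂} T₁ T₂)
  inOrR : ∀ {A B φ₁ φ₂ T₁ T₂} → Sub S T₂ → Sub S (estOr {A} {B} {φ₁} {φ₂} T₁ T₂)
  inAndL : ∀ {A B φ₁ φ₂ T₁ T₂} → Sub S T₁ → Sub S (estAnd {A} {B} {φ₁} {φ₂} T₁ T₂)
  inAndR : ∀ {A B φ₁ φ₂ T₁ T₂} → Sub S T₂ → Sub S (estAnd {A} {B} {φ₁} {φ₂} T₁ T₂)
  inEx  : ∀ {A B u φ ch s T} → Sub S T → Sub S (estEx {A} {B} {u} {φ} ch s T)
  inAll : ∀ {A B u φ ch s T} → Sub S T → Sub S (estAll {A} {B} {u} {φ} ch s T)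

childIL : ∀ {A B} (Q : Quant) (u : Var) (φ : Formula) → EST A B (quant Q u φ) → ISet × ISet
childIL ∃Q u φ (estEx {A} {B} ch s T) = chosen A u ch , allExt B u
childIL ∀Q u φ (estAll {A} {B} ch s T) = allExt A u , chosen B u ch

-- Potential separators δ : 𝒫₂({min,max,x,y,z}) → ℕ.
-- Represented as Term → Term → ℕ, always read through the symmetric
-- accessor δ ⟨ s , t ⟩ (entries for unsorted / diagonal pairs are unused).

Pot : Set
Pot = Term → Term → ℕ

idx : Term → ℕ
idx tmin = 0
idx tmax = 1
idx (var x) = 2
idx (var y) = 3
idx (var z) = 4

_⟨_,_⟩ : Pot → Term → Term → ℕ
δ ⟨ s , t ⟩ = if idx s ≤ᵇ idx t then δ s t else δ t s

data LType : Set where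
  ltT eqT gtT : LType

ltype : ℕ → ℕ → LType
ltype m n = if m <ᵇ n then ltT else (if n <ᵇ m then gtT else eqT)

diff : ℕ → ℕ → ℤ
diff m n = + m ℤ.- + n

Separator : Pot → ISet → ISet → Set
Separator δ A B =
  (I J : Interp) → A I → B J →
  Σ Term λ s → Σ Term λ t →
    s ≢ t × 1 ≤ δ ⟨ s , t ⟩ ×
    ( ltype (val I s) (val I t) ≢ ltype (val J s) (val J t)
    ⊎ ( (ℤ.∣ diff (val I s) (val I t) ∣ ⊓ ℤ.∣ diff (val J s) (val J t) ∣) ≤ δ ⟨ s , t ⟩
      × diff (val I s) (val I t) ≢ diff (val J s) (val J t)))

eqTerm : Term → Term → Bool
eqTerm s t = idx s Data.Nat.≡ᵇ idx t

-- δ̃ from δ₁ and the quantified variable u: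
--   δ̃{u,s} = 0, and for pairs {s,t} not containing u:
--   δ̃{s,t} = max{δ₁{s,t}, δ₁{s,u} + δ₁{u,t} + 1}
-- (this single clause covers the three cases {min,max}, {u',u''}, {m,u'}).
tilde : Pot → Var → Pot
tilde δ u s t =
  if eqTerm s (var u) then 0 else
  (if eqTerm t (var u) then 0 else
   (δ ⟨ s , t ⟩ ⊔ (δ ⟨ s , var u ⟩ + δ ⟨ var u , t ⟩ + 1)))

-- Fix I ∈ A', J ∈ B' and the witness a chosen for u in I (the ∀ case is the mirror image, with the
-- roles of I and J swapped). Two pairs of positions are alike at budget d when they are not apart at d:
-- they have the same gap, or both gaps exceed d in the same direction. If some pair of terms other than
-- u is apart in I, J at budget δ̃, that pair separates. Otherwise every such pair s, t is alike at
-- δ₁{u,s} + δ₁{u,t} + 1, and this slack lets us place u at some b in J so that every other term t sees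
-- a and b alike at δ₁{u,t}: copy the offset of a from a term near a if there is one, and otherwise put
-- b just beyond, in J, the reach of all terms lying left of a. The child separator δ₁ separates
-- I[a/u] from J[b/u]; its separating pair cannot contain u, so it is a pair of I, J, where δ̃ ≥ δ₁.
module Submission where

open import Data.Bool using (true; false)
open import Data.Fin using (Fin; toℕ; fromℕ<)
open import Data.Fin.Properties using (toℕ≤pred[n]; toℕ-fromℕ<)
open import Data.Integer as ℤ using (ℤ; +[1+_]; -[1+_]; _⊖_)
import Data.Integer.Properties as ℤP
open import Data.List using (List; []; _∷_; filter)
open import Data.List.Extrema.Nat using (argmax; argmax-all; f[xs]≤f[argmax])
open import Data.List.Membership.Propositional using (_∈_)
open import Data.List.Membership.Propositional.Properties using (∈-filter⁺)
open import Data.List.Relation.Unary.All using (lookup)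
open import Data.List.Relation.Unary.All.Properties using (all-filter)
open import Data.List.Relation.Unary.Any using (here; there)
open import Data.Nat
open import Data.Nat.Properties
open import Data.Nat.Tactic.RingSolver using (solve-∀; solve)
open import Data.Product using (Σ; _×_; _,_; proj₁; proj₂)
open import Data.Sum using (_⊎_; inj₁; inj₂)
open import Function using (_∘_)
open import Relation.Binary.Definitions using (DecidableEquality)
open import Relation.Binary.PropositionalEquality
  using (_≡_; _≢_; refl; sym; trans; cong; cong₂; subst; module ≡-Reasoning)
open import Relation.Nullary
open import Relation.Nullary.Decidable using (dec-true; dec-false; map′; ¬?; _×-dec_)
open import Defs

eqVar-reflects : ∀ w v → Reflects (w ≡ v) (eqVar w v)
eqVar-reflects x x = ofʸ refl
eqVar-reflects x y = ofⁿ λ ()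
eqVar-reflects x z = ofⁿ λ ()
eqVar-reflects y x = ofⁿ λ ()
eqVar-reflects y y = ofʸ refl
eqVar-reflects y z = ofⁿ λ ()
eqVar-reflects z x = ofⁿ λ ()
eqVar-reflects z y = ofⁿ λ ()
eqVar-reflects z z = ofʸ refl

_≟ᵛ_ : DecidableEquality Var
w ≟ᵛ v = eqVar w v because eqVar-reflects w v

var-injective : ∀ {w v} → var w ≡ var v → w ≡ v
var-injective refl = refl

_≟var_ : (t : Term) (v : Var) → Dec (t ≡ var v)
tmin ≟var v = no λ ()
tmax ≟var v = no λ ()
var w ≟var v = map′ (cong var) var-injective (w ≟ᵛ v)

idx⁻¹ : ℕ → Term
idx⁻¹ 0 = tmin
idx⁻¹ 1 = tmax
idx⁻¹ 2 = var x
idx⁻¹ 3 = var y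
idx⁻¹ _ = var z

idx⁻¹-idx : ∀ t → idx⁻¹ (idx t) ≡ t
idx⁻¹-idx tmin    = refl
idx⁻¹-idx tmax    = refl
idx⁻¹-idx (var x) = refl
idx⁻¹-idx (var y) = refl
idx⁻¹-idx (var z) = refl

idx-injective : ∀ {s t} → idx s ≡ idx t → s ≡ t
idx-injective {s} {t} eq = trans (sym (idx⁻¹-idx s)) (trans (cong idx⁻¹ eq) (idx⁻¹-idx t))

eqTerm-≢ : ∀ {s t} → s ≢ t → eqTerm s t ≡ false
eqTerm-≢ {s} {t} s≢t = dec-false (idx s ≟ idx t) (s≢t ∘ idx-injective)

eqVar-≢ : ∀ {w v} → w ≢ v → eqVar w v ≡ false
eqVar-≢ {w} {v} = dec-false (w ≟ᵛ v)

some-or-all : {P Q : Term → Set} → (∀ t → P t ⊎ Q t) → Σ Term P ⊎ (∀ t → Q t)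
some-or-all P⊎Q with P⊎Q tmin | P⊎Q tmax | P⊎Q (var x) | P⊎Q (var y) | P⊎Q (var z)
... | inj₁ p  | _       | _       | _       | _       = inj₁ (_ , p)
... | inj₂ _  | inj₁ p  | _       | _       | _       = inj₁ (_ , p)
... | inj₂ _  | inj₂ _  | inj₁ p  | _       | _       = inj₁ (_ , p)
... | inj₂ _  | inj₂ _  | inj₂ _  | inj₁ p  | _       = inj₁ (_ , p)
... | inj₂ _  | inj₂ _  | inj₂ _  | inj₂ _  | inj₁ p  = inj₁ (_ , p)
... | inj₂ q₁ | inj₂ q₂ | inj₂ q₃ | inj₂ q₄ | inj₂ q₅ =
  inj₂ λ { tmin → q₁ ; tmax → q₂ ; (var x) → q₃ ; (var y) → q₄ ; (var z) → q₅ }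

some-or-all² : {P Q : Term → Term → Set} → (∀ s t → P s t ⊎ Q s t) →
               (Σ Term λ s → Σ Term (P s)) ⊎ (∀ s t → Q s t)
some-or-all² P⊎Q = some-or-all (λ s → some-or-all (P⊎Q s))

allTerms : List Term
allTerms = tmin ∷ tmax ∷ var x ∷ var y ∷ var z ∷ []

∈-allTerms : ∀ t → t ∈ allTerms
∈-allTerms tmin    = here refl
∈-allTerms tmax    = there (here refl)
∈-allTerms (var x) = there (there (here refl))
∈-allTerms (var y) = there (there (there (here refl)))
∈-allTerms (var z) = there (there (there (there (here refl))))

val-upd-≢ : ∀ I {v} a t → t ≢ var v → val (upd I v a) t ≡ val I t
val-upd-≢ (_ , _) _ tmin    _   = refl
val-upd-≢ (_ , _) _ tmax    _   = refl
val-upd-≢ (_ , _) _ (var w) w≢v rewrite eqVar-≢ (w≢v ∘ cong var) = refl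

val-upd-var : ∀ I v a → val (upd I v a) (var v) ≡ toℕ a
val-upd-var (_ , _) v a rewrite dec-true (v ≟ᵛ v) refl = refl

⟨⟩-comm : (δ : Pot) (s t : Term) → δ ⟨ s , t ⟩ ≡ δ ⟨ t , s ⟩
⟨⟩-comm δ s t with idx s ≤ᵇ idx t | ≤ᵇ-reflects-≤ (idx s) (idx t)
                 | idx t ≤ᵇ idx s | ≤ᵇ-reflects-≤ (idx t) (idx s)
... | true  | ofʸ s≤t | true  | ofʸ t≤s rewrite idx-injective (≤-antisym s≤t t≤s) = refl
... | true  | _       | false | _       = refl
... | false | _       | true  | _       = refl
... | false | ofⁿ s≰t | false | ofⁿ t≰s = contradiction (≰⇒≥ t≰s) s≰t

tilde-≢ : (δ : Pot) {u : Var} {s t : Term} → s ≢ var u → t ≢ var u →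
          tilde δ u s t ≡ δ ⟨ s , t ⟩ ⊔ (δ ⟨ var u , s ⟩ + δ ⟨ var u , t ⟩ + 1)
tilde-≢ δ {u} {s} {t} s≢u t≢u rewrite eqTerm-≢ s≢u | eqTerm-≢ t≢u =
  cong (λ k → δ ⟨ s , t ⟩ ⊔ (k + δ ⟨ var u , t ⟩ + 1)) (⟨⟩-comm δ s (var u))

⟨⟩-of-comm : (f : Pot) {s t : Term} → f s t ≡ f t s → f ⟨ s , t ⟩ ≡ f s t
⟨⟩-of-comm f {s} {t} comm with idx s ≤ᵇ idx t
... | true  = refl
... | false = sym comm

tilde-⟨⟩-≢ : (δ : Pot) {u : Var} {s t : Term} → s ≢ var u → t ≢ var u →
             tilde δ u ⟨ s , t ⟩ ≡ δ ⟨ s , t ⟩ ⊔ (δ ⟨ var u , s ⟩ + δ ⟨ var u , t ⟩ + 1)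
tilde-⟨⟩-≢ δ {u} {s} {t} s≢u t≢u =
  trans (⟨⟩-of-comm (tilde δ u) {s} {t} comm) (tilde-≢ δ s≢u t≢u)
  where
  comm : tilde δ u s t ≡ tilde δ u t s
  comm = begin
    tilde δ u s t
      ≡⟨ tilde-≢ δ s≢u t≢u ⟩
    δ ⟨ s , t ⟩ ⊔ (δ ⟨ var u , s ⟩ + δ ⟨ var u , t ⟩ + 1)
      ≡⟨ cong₂ _⊔_ (⟨⟩-comm δ s t) (cong (_+ 1) (+-comm (δ ⟨ var u , s ⟩) _)) ⟩
    δ ⟨ t , s ⟩ ⊔ (δ ⟨ var u , t ⟩ + δ ⟨ var u , s ⟩ + 1)
      ≡⟨ tilde-≢ δ t≢u s≢u ⟨
    tilde δ u t s
      ∎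
    where open ≡-Reasoning

tilde-≥-δ : (δ : Pot) {u : Var} {s t : Term} → s ≢ var u → t ≢ var u →
            δ ⟨ s , t ⟩ ≤ tilde δ u ⟨ s , t ⟩
tilde-≥-δ δ s≢u t≢u = ≤-trans (m≤m⊔n _ _) (≤-reflexive (sym (tilde-⟨⟩-≢ δ s≢u t≢u)))

tilde-≥-detour : (δ : Pot) {u : Var} {s t : Term} → s ≢ var u → t ≢ var u →
                 δ ⟨ var u , s ⟩ + δ ⟨ var u , t ⟩ + 1 ≤ tilde δ u ⟨ s , t ⟩
tilde-≥-detour δ s≢u t≢u = ≤-trans (m≤n⊔m _ _) (≤-reflexive (sym (tilde-⟨⟩-≢ δ s≢u t≢u)))

diff≡⊖ : ∀ m n → diff m n ≡ m ⊖ n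
diff≡⊖ = ℤP.[+m]-[+n]≡m⊖n

diff-+ : ∀ m n o → diff (m + n) (m + o) ≡ n ⊖ o
diff-+ m n o = trans (diff≡⊖ (m + n) (m + o)) (ℤP.+-cancelˡ-⊖ m n o)

diff-less : ∀ m k → diff m (suc (m + k)) ≡ -[1+ k ]
diff-less m k = begin
  diff m (suc (m + k))     ≡⟨ cong₂ diff (sym (+-identityʳ m)) (sym (+-suc m k)) ⟩
  diff (m + 0) (m + suc k) ≡⟨ diff-+ m 0 (suc k) ⟩
  -[1+ k ]                 ∎
  where open ≡-Reasoning

diff-greater : ∀ m k → diff (suc (m + k)) m ≡ +[1+ k ]
diff-greater m k = begin
  diff (suc (m + k)) m     ≡⟨ cong₂ diff (sym (+-suc m k)) (sym (+-identityʳ m)) ⟩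
  diff (m + suc k) (m + 0) ≡⟨ diff-+ m (suc k) 0 ⟩
  +[1+ k ]                 ∎
  where open ≡-Reasoning

diff-self : ∀ m → diff m m ≡ ℤ.+ 0
diff-self m = trans (diff≡⊖ m m) (ℤP.n⊖n≡0 m)

same-gap⇒diff : ∀ p p' q q' → p + q' ≡ q + p' → diff p p' ≡ diff q q'
same-gap⇒diff p p' q q' eq = begin
  diff p p'                ≡⟨ diff≡⊖ p p' ⟩
  p ⊖ p'                   ≡⟨ sym (diff-+ q' p p') ⟩
  diff (q' + p) (q' + p')  ≡⟨ cong₂ diff (trans (+-comm q' p) (trans eq (+-comm q p')))
                                         (+-comm q' p') ⟩
  diff (p' + q) (p' + q')  ≡⟨ diff-+ p' q q' ⟩
  q ⊖ q'                   ≡⟨ sym (diff≡⊖ q q') ⟩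
  diff q q'                ∎
  where open ≡-Reasoning

ltype-< : ∀ {m n} → m < n → ltype m n ≡ ltT
ltype-< {m} {n} m<n with m <ᵇ n | <ᵇ-reflects-< m n
... | true  | _        = refl
... | false | ofⁿ m≮n = contradiction m<n m≮n

ltype-> : ∀ {m n} → n < m → ltype m n ≡ gtT
ltype-> {m} {n} n<m with m <ᵇ n | <ᵇ-reflects-< m n | n <ᵇ m | <ᵇ-reflects-< n m
... | true  | ofʸ m<n | _     | _        = contradiction m<n (<⇒≯ n<m)
... | false | _       | true  | _        = refl
... | false | _       | false | ofⁿ n≮m = contradiction n<m n≮m

ltype-≡ : ∀ m → ltype m m ≡ eqT
ltype-≡ m with m <ᵇ m | <ᵇ-reflects-< m m
... | true  | ofʸ m<m = contradiction m<m (n≮n m)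
... | false | _       = refl

ltype-less : ∀ m k → ltype m (suc (m + k)) ≡ ltT
ltype-less m k = ltype-< (s≤s (m≤m+n m k))

ltype-greater : ∀ m k → ltype (suc (m + k)) m ≡ gtT
ltype-greater m k = ltype-> (s≤s (m≤m+n m k))

ltypeᶻ : ℤ → LType
ltypeᶻ -[1+ _ ] = ltT
ltypeᶻ (ℤ.+ zero) = eqT
ltypeᶻ +[1+ _ ] = gtT

ltype≡ltypeᶻ-diff : ∀ m n → ltype m n ≡ ltypeᶻ (diff m n)
ltype≡ltypeᶻ-diff m n with compare m n
... | less _ k    rewrite diff-less m k    = ltype-less m k
... | equal _     rewrite diff-self m      = ltype-≡ m
... | greater n k rewrite diff-greater n k = ltype-greater n k

data Apart (d p p' q q' : ℕ) : Set where
  types-differ : ltype p p' ≢ ltype q q' → Apart d p p' q q'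
  gaps-differ  : ℤ.∣ diff p p' ∣ ⊓ ℤ.∣ diff q q' ∣ ≤ d → diff p p' ≢ diff q q' →
                 Apart d p p' q q'

-- The complement of Apart (apart-or-alike, alike⇒¬apart), stated in ℕ so that budgets can be
-- traded arithmetically.
data Alike (d p p' q q' : ℕ) : Set where
  same-gap  : p + q' ≡ q + p' → Alike d p p' q q'
  far-below : p' + d < p → q' + d < q → Alike d p p' q q'
  far-above : p + d < p' → q + d < q' → Alike d p p' q q'

apart-cong : ∀ {d p₁ p₁' q₁ q₁' p₂ p₂' q₂ q₂'} → p₁ ≡ p₂ → p₁' ≡ p₂' → q₁ ≡ q₂ → q₁' ≡ q₂' →
             Apart d p₁ p₁' q₁ q₁' → Apart d p₂ p₂' q₂ q₂'
apart-cong refl refl refl refl apart = apart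

alike-refl : ∀ d p q → Alike d p p q q
alike-refl d p q = same-gap (+-comm p q)

≤⇒+≮ : ∀ {p p' d} → p ≤ p' → p' + d ≮ p
≤⇒+≮ {p' = p'} {d} p≤p' h = <⇒≱ h (≤-trans p≤p' (m≤m+n p' d))

record Beyond (d p p' : ℕ) (τ : LType) : Set where
  constructor beyond
  field
    ltype≡ : ltype p p' ≡ τ
    budget< : d < ℤ.∣ diff p p' ∣

m+d<1+[m+k]⇒d<1+k : ∀ m d k → m + d < suc (m + k) → d < suc k
m+d<1+[m+k]⇒d<1+k m d k h = +-cancelˡ-< m d (suc k) (subst (m + d <_) (sym (+-suc m k)) h)

far-below-beyond : ∀ {d p p'} → p' + d < p → Beyond d p p' gtT
far-below-beyond {d} {p} {p'} h with compare p p'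
... | less _ k    = contradiction h (≤⇒+≮ (m≤n⇒m≤1+n (m≤m+n p k)))
... | equal _     = contradiction h (≤⇒+≮ ≤-refl)
... | greater _ k = beyond (ltype-greater p' k)
  (subst (λ i → d < ℤ.∣ i ∣) (sym (diff-greater p' k)) (m+d<1+[m+k]⇒d<1+k p' d k h))

far-above-beyond : ∀ {d p p'} → p + d < p' → Beyond d p p' ltT
far-above-beyond {d} {p} {p'} h with compare p p'
... | less _ k    = beyond (ltype-less p k)
  (subst (λ i → d < ℤ.∣ i ∣) (sym (diff-less p k)) (m+d<1+[m+k]⇒d<1+k p d k h))
... | equal _     = contradiction h (≤⇒+≮ ≤-refl)
... | greater _ k = contradiction h (≤⇒+≮ (m≤n⇒m≤1+n (m≤m+n p' k)))

beyond⇒¬apart : ∀ {d p p' q q' τ} → Beyond d p p' τ → Beyond d q q' τ → ¬ Apart d p p' q q'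
beyond⇒¬apart (beyond τp _) (beyond τq _) (types-differ τ≢) = τ≢ (trans τp (sym τq))
beyond⇒¬apart (beyond _ dp) (beyond _ dq) (gaps-differ ≤d _) = <⇒≱ (⊓-glb dp dq) ≤d

alike⇒¬apart : ∀ {d p p' q q'} → Alike d p p' q q' → ¬ Apart d p p' q q'
alike⇒¬apart {p = p} {p'} {q} {q'} (same-gap eq) (types-differ τ≢) = τ≢ (begin
  ltype p p'          ≡⟨ ltype≡ltypeᶻ-diff p p' ⟩
  ltypeᶻ (diff p p')  ≡⟨ cong ltypeᶻ (same-gap⇒diff p p' q q' eq) ⟩
  ltypeᶻ (diff q q')  ≡⟨ ltype≡ltypeᶻ-diff q q' ⟨
  ltype q q'          ∎)
  where open ≡-Reasoning
alike⇒¬apart {p = p} {p'} {q} {q'} (same-gap eq) (gaps-differ _ diff≢) =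
  diff≢ (same-gap⇒diff p p' q q' eq)
alike⇒¬apart (far-below h h') = beyond⇒¬apart (far-below-beyond h) (far-below-beyond h')
alike⇒¬apart (far-above h h') = beyond⇒¬apart (far-above-beyond h) (far-above-beyond h')

apart-by-ltypes : ∀ {d p p' q q' τ σ} → ltype p p' ≡ τ → ltype q q' ≡ σ → τ ≢ σ →
                  Apart d p p' q q'
apart-by-ltypes τp σq τ≢σ = types-differ λ eq → τ≢σ (trans (sym τp) (trans eq σq))

apart-by-gaps : ∀ {d p p' q q' i j} → diff p p' ≡ i → diff q q' ≡ j →
                ℤ.∣ i ∣ ⊓ ℤ.∣ j ∣ ≤ d → i ≢ j → Apart d p p' q q'
apart-by-gaps refl refl = gaps-differ

apart-or-alike : ∀ d p p' q q' → Apart d p p' q q' ⊎ Alike d p p' q q'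
apart-or-alike d p p' q q' with compare p p' | compare q q'
... | less _ k    | equal _     = inj₁ (apart-by-ltypes (ltype-less p k) (ltype-≡ q) λ ())
... | less _ k    | greater _ l = inj₁ (apart-by-ltypes (ltype-less p k) (ltype-greater q' l) λ ())
... | equal _     | less _ l    = inj₁ (apart-by-ltypes (ltype-≡ p) (ltype-less q l) λ ())
... | equal _     | greater _ l = inj₁ (apart-by-ltypes (ltype-≡ p) (ltype-greater q' l) λ ())
... | greater _ k | less _ l    = inj₁ (apart-by-ltypes (ltype-greater p' k) (ltype-less q l) λ ())
... | greater _ k | equal _     = inj₁ (apart-by-ltypes (ltype-greater p' k) (ltype-≡ q) λ ())
... | equal _     | equal _     = inj₂ (alike-refl d p q)
... | less _ k    | less _ l    with k ≟ l | d ≤? k | d ≤? l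
...   | yes refl | _       | _       = inj₂ (same-gap (solve (p ∷ q ∷ k ∷ [])))
...   | no _     | yes d≤k | yes d≤l =
  inj₂ (far-above (s≤s (+-monoʳ-≤ p d≤k)) (s≤s (+-monoʳ-≤ q d≤l)))
...   | no k≢l   | no d≰k  | _       = inj₁ (apart-by-gaps (diff-less p k) (diff-less q l)
  (≤-trans (m⊓n≤m _ _) (≰⇒> d≰k)) (k≢l ∘ ℤP.-[1+-injective))
...   | no k≢l   | yes _   | no d≰l  = inj₁ (apart-by-gaps (diff-less p k) (diff-less q l)
  (≤-trans (m⊓n≤n _ _) (≰⇒> d≰l)) (k≢l ∘ ℤP.-[1+-injective))
apart-or-alike d p p' q q' | greater _ k | greater _ l with k ≟ l | d ≤? k | d ≤? l
...   | yes refl | _       | _       = inj₂ (same-gap (solve (p' ∷ q' ∷ k ∷ [])))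
...   | no _     | yes d≤k | yes d≤l =
  inj₂ (far-below (s≤s (+-monoʳ-≤ p' d≤k)) (s≤s (+-monoʳ-≤ q' d≤l)))
...   | no k≢l   | no d≰k  | _       = inj₁ (apart-by-gaps (diff-greater p' k) (diff-greater q' l)
  (≤-trans (m⊓n≤m _ _) (≰⇒> d≰k)) (k≢l ∘ ℤP.+[1+-injective))
...   | no k≢l   | yes _   | no d≰l  = inj₁ (apart-by-gaps (diff-greater p' k) (diff-greater q' l)
  (≤-trans (m⊓n≤n _ _) (≰⇒> d≰l)) (k≢l ∘ ℤP.+[1+-injective))

apart-irrefl : ∀ {d} p q → ¬ Apart d p p q q
apart-irrefl {d} p q = alike⇒¬apart (alike-refl d p q)

apart-mono : ∀ {d d' p p' q q'} → d ≤ d' → Apart d p p' q q' → Apart d' p p' q q'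
apart-mono _    (types-differ τ≢)      = types-differ τ≢
apart-mono d≤d' (gaps-differ ≤d diff≢) = gaps-differ (≤-trans ≤d d≤d') diff≢

apart-sym : ∀ {d p p' q q'} → Apart d p p' q q' → Apart d q q' p p'
apart-sym (types-differ τ≢) = types-differ (τ≢ ∘ sym)
apart-sym {d} {p} {p'} {q} {q'} (gaps-differ ≤d diff≢) =
  gaps-differ (subst (_≤ d) (⊓-comm ℤ.∣ diff p p' ∣ ℤ.∣ diff q q' ∣) ≤d) (diff≢ ∘ sym)

alike-mono : ∀ {d d' p p' q q'} → d' ≤ d → Alike d p p' q q' → Alike d' p p' q q'
alike-mono _    (same-gap eq)   = same-gap eq
alike-mono d'≤d (far-below h h') =
  far-below (≤-<-trans (+-monoʳ-≤ _ d'≤d) h) (≤-<-trans (+-monoʳ-≤ _ d'≤d) h')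
alike-mono d'≤d (far-above h h') =
  far-above (≤-<-trans (+-monoʳ-≤ _ d'≤d) h) (≤-<-trans (+-monoʳ-≤ _ d'≤d) h')

alike-flip : ∀ {d p p' q q'} → Alike d p p' q q' → Alike d p' p q' q
alike-flip {p = p} {p'} {q} {q'} (same-gap eq) =
  same-gap (trans (+-comm p' q) (trans (sym eq) (+-comm p q')))
alike-flip (far-below h h') = far-above h h'
alike-flip (far-above h h') = far-below h h'

alike-bound : ∀ {e a N b M} → a ≤ N → Alike e a N b M → b ≤ M
alike-bound {a = a} {N} {b} {M} a≤N (same-gap eq) = +-cancelʳ-≤ N b M (begin
  b + N ≡⟨ sym eq ⟩
  a + M ≤⟨ +-monoˡ-≤ M a≤N ⟩
  N + M ≡⟨ +-comm N M ⟩
  M + N ∎)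
  where open ≤-Reasoning
alike-bound a≤N (far-below h _) = contradiction h (≤⇒+≮ a≤N)
alike-bound {e} {b = b} _ (far-above _ h) = ≤-trans (m≤m+n b e) (<⇒≤ h)

alike-anchor : ∀ {P a e f Q} → P ≤ a + e → Alike (e + f + 1) P 0 Q 0 → P ≤ Q + a
alike-anchor {P} {a} {Q = Q} _ (same-gap eq) = begin
  P      ≡⟨ sym (+-identityʳ P) ⟩
  P + 0  ≡⟨ eq ⟩
  Q + 0  ≤⟨ +-monoʳ-≤ Q z≤n ⟩
  Q + a  ∎
  where open ≤-Reasoning
alike-anchor {P} {a} {e} {f} {Q} P≤a+e (far-below _ h) = begin
  P      ≤⟨ P≤a+e ⟩
  a + e  ≤⟨ +-monoʳ-≤ a (≤-trans (m≤m+n e f) (≤-trans (m≤m+n (e + f) 1) (<⇒≤ h))) ⟩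
  a + Q  ≡⟨ +-comm a Q ⟩
  Q + a  ∎
  where open ≤-Reasoning

+-budget : ∀ m e f → m + (e + f + 1) ≡ suc (m + e + f)
+-budget = solve-∀

gap-≤ : ∀ {X Y W V e} → X ≤ Y + e → X + W ≡ V + Y → V ≤ W + e
gap-≤ {X} {Y} {W} {V} {e} X≤Y+e eq = +-cancelʳ-≤ Y V (W + e) (begin
  V + Y      ≡⟨ sym eq ⟩
  X + W      ≤⟨ +-monoˡ-≤ W X≤Y+e ⟩
  Y + e + W  ≡⟨ solve (Y ∷ e ∷ W ∷ []) ⟩
  W + e + Y  ∎)
  where open ≤-Reasoning

below-shift : ∀ {P a p'} e f → P ≤ a + e → p' + (e + f + 1) < P → p' + f < a
below-shift {P} {a} {p'} e f P≤a+e h = +-cancelʳ-≤ e (suc (p' + f)) a (begin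
  suc (p' + f) + e  ≡⟨ solve (p' ∷ f ∷ e ∷ []) ⟩
  p' + (e + f + 1)  ≤⟨ <⇒≤ h ⟩
  P                 ≤⟨ P≤a+e ⟩
  a + e             ∎)
  where open ≤-Reasoning

above-shift : ∀ {P a p'} e f → a ≤ P + e → P + (e + f + 1) < p' → a + f < p'
above-shift {P} {a} {p'} e f a≤P+e h = begin-strict
  a + f             ≤⟨ +-monoˡ-≤ f a≤P+e ⟩
  P + e + f         <⟨ n<1+n _ ⟩
  suc (P + e + f)   ≡⟨ +-budget P e f ⟨
  P + (e + f + 1)   <⟨ h ⟩
  p'                ∎
  where open ≤-Reasoning

alike-transfer : ∀ {a P Q b e f p' q'} → a ≤ P + e → P ≤ a + e → P + b ≡ Q + a →
                 Alike (e + f + 1) P p' Q q' → Alike f a p' b q'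
alike-transfer {a} {P} {Q} {b} {p' = p'} {q'} _ _ P+b≡Q+a (same-gap eq) =
  same-gap (+-cancelˡ-≡ Q _ _ (begin
  Q + (a + q')  ≡⟨ sym (+-assoc Q a q') ⟩
  Q + a + q'    ≡⟨ cong (_+ q') (sym P+b≡Q+a) ⟩
  P + b + q'    ≡⟨ solve (P ∷ b ∷ q' ∷ []) ⟩
  b + (P + q')  ≡⟨ cong (b +_) eq ⟩
  b + (Q + p')  ≡⟨ solve (b ∷ Q ∷ p' ∷ []) ⟩
  Q + (b + p')  ∎))
  where open ≡-Reasoning
alike-transfer {a} {P} {Q} {b} {e} {f} _ P≤a+e P+b≡Q+a (far-below h h') =
  far-below (below-shift e f P≤a+e h) (below-shift e f (gap-≤ {Y = a} P≤a+e P+b≡Q+a) h')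
alike-transfer {a} {P} {Q} {b} {e} {f} a≤P+e _ P+b≡Q+a (far-above h h') =
  far-above (above-shift e f a≤P+e h) (above-shift e f (gap-≤ {Y = P} a≤P+e a+Q≡b+P) h')
  where
  a+Q≡b+P : a + Q ≡ b + P
  a+Q≡b+P = trans (+-comm a Q) (trans (sym P+b≡Q+a) (+-comm P b))

alike-past : ∀ {P a e f p' Q q'} → P + e < a → a + f < p' → Alike (e + f + 1) P p' Q q' →
             suc (Q + e) + f < q'
alike-past {P} {a} {e} {f} {p'} {Q} {q'} P+e<a a+f<p' (same-gap eq) = +-cancelˡ-≤ P _ _ (begin
  P + suc (suc (Q + e) + f)  ≡⟨ solve (P ∷ Q ∷ e ∷ f ∷ []) ⟩
  Q + (suc (P + e) + suc f)  ≤⟨ +-monoʳ-≤ Q (+-monoˡ-≤ (suc f) P+e<a) ⟩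
  Q + (a + suc f)            ≡⟨ cong (Q +_) (+-suc a f) ⟩
  Q + suc (a + f)            ≤⟨ +-monoʳ-≤ Q a+f<p' ⟩
  Q + p'                     ≡⟨ sym eq ⟩
  P + q'                     ∎)
  where open ≤-Reasoning
alike-past {P} {a} {e} {f} {p'} P+e<a a+f<p' (far-below h _) = contradiction h (≤⇒+≮ P≤p')
  where
  P≤p' : P ≤ p'
  P≤p' = begin
    P      ≤⟨ m≤m+n P e ⟩
    P + e  ≤⟨ <⇒≤ P+e<a ⟩
    a      ≤⟨ m≤m+n a f ⟩
    a + f  ≤⟨ <⇒≤ a+f<p' ⟩
    p'     ∎
    where open ≤-Reasoning
alike-past {e = e} {f} {Q = Q} {q'} _ _ (far-above _ h) =
  subst (_< q') (+-budget Q e f) h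

-- Placing u in J: the extra step through u allowed by `pairwise` is exactly the room b needs.
module Extension
  (u : Var) (d : Term → ℕ) {N M : ℕ} (α : Var → Fin (suc N)) (β : Var → Fin (suc M))
  (pairwise : ∀ {s t} → s ≢ var u → t ≢ var u →
              Alike (d s + d t + 1) (val (N , α) s) (val (N , α) t) (val (M , β) s) (val (M , β) t))
  (a : ℕ) where

  p q : Term → ℕ
  p = val (N , α)
  q = val (M , β)

  Extends : ℕ → Set
  Extends b = ∀ {t} → t ≢ var u → Alike (d t) a (p t) b (q t)

  Near Left : Term → Set
  Near t = t ≢ var u × a ≤ p t + d t × p t ≤ a + d t
  Left t = t ≢ var u × p t + d t < a

  near-or-far : ∀ t → Near t ⊎ (t ≢ var u → Left t ⊎ a + d t < p t)
  near-or-far t with t ≟var u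
  ... | yes t≡u = inj₂ λ t≢u → contradiction t≡u t≢u
  ... | no t≢u with p t + d t <? a | a + d t <? p t
  ...   | yes left | _         = inj₂ λ _ → inj₁ (t≢u , left)
  ...   | no _     | yes right = inj₂ λ _ → inj₂ right
  ...   | no ≮a    | no ≯a     = inj₁ (t≢u , ≮⇒≥ ≮a , ≮⇒≥ ≯a)

  -- b keeps the offset of a from w; the anchor (w against min) keeps ∸ from truncating.
  extends-from-near : ∀ {w} → Near w → Σ ℕ Extends
  extends-from-near {w} (w≢u , a≤ , ≤a) =
    q w + a ∸ p w , λ t≢u → alike-transfer a≤ ≤a (m+[n∸m]≡n anchor) (pairwise w≢u t≢u)
    where
    anchor : p w ≤ q w + a
    anchor = alike-anchor ≤a (pairwise {t = tmin} w≢u λ ())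

  module _ (far : ∀ {t} → t ≢ var u → Left t ⊎ a + d t < p t) where

    left? : ∀ t → Dec (Left t)
    left? t = ¬? (t ≟var u) ×-dec (p t + d t <? a)

    tmin-left : Left tmin
    tmin-left with far {tmin} (λ ())
    ... | inj₁ left = left
    ... | inj₂ ()

    reach : Term → ℕ
    reach t = q t + d t

    lefts : List Term
    lefts = filter left? allTerms

    last-left : Term
    last-left = argmax reach tmin lefts

    last-left-left : Left last-left
    last-left-left = argmax-all reach tmin-left (all-filter left? allTerms)

    reach≤last-left : ∀ {t} → Left t → reach t ≤ reach last-left
    reach≤last-left {t} left =
      lookup (f[xs]≤f[argmax] tmin lefts) (∈-filter⁺ left? (∈-allTerms t) left)

    extends-from-far : Σ ℕ Extends
    extends-from-far = suc (reach last-left) , extends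
      where
      extends : Extends (suc (reach last-left))
      extends t≢u with far t≢u
      ... | inj₁ left  = far-below (proj₂ left) (s≤s (reach≤last-left left))
      ... | inj₂ right = far-above right
        (alike-past (proj₂ last-left-left) right (pairwise (proj₁ last-left-left) t≢u))

  extension : Σ ℕ Extends
  extension with some-or-all near-or-far
  ... | inj₁ (_ , near) = extends-from-near near
  ... | inj₂ far        = extends-from-far (λ {t} → far t)

  extension-fin : a ≤ N → Σ (Fin (suc M)) λ b → Extends (toℕ b)
  extension-fin a≤N with extension
  ... | b , extends = fromℕ< (s≤s b≤M) , subst Extends (sym (toℕ-fromℕ< (s≤s b≤M))) extends
    where
    b≤M : b ≤ M
    b≤M = alike-bound a≤N (extends {tmax} (λ ()))

Separates : Pot → Interp → Interp → Set
Separates δ I J = Σ Term λ s → Σ Term λ t →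
  s ≢ t × 1 ≤ δ ⟨ s , t ⟩ × Apart (δ ⟨ s , t ⟩) (val I s) (val I t) (val J s) (val J t)

separates-sym : ∀ {δ I J} → Separates δ I J → Separates δ J I
separates-sym (s , t , s≢t , pos , apart) = s , t , s≢t , pos , apart-sym apart

fromSeparator : ∀ {δ A B} → Separator δ A B → ∀ {I J} → A I → B J → Separates δ I J
fromSeparator sep {I} {J} I∈A J∈B with sep I J I∈A J∈B
... | s , t , s≢t , pos , inj₁ τ≢          = s , t , s≢t , pos , types-differ τ≢
... | s , t , s≢t , pos , inj₂ (≤d , diff≢) = s , t , s≢t , pos , gaps-differ ≤d diff≢

toSeparator : ∀ {δ A B} → (∀ I J → A I → B J → Separates δ I J) → Separator δ A B
toSeparator sep I J I∈A J∈B with sep I J I∈A J∈B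
... | s , t , s≢t , pos , types-differ τ≢      = s , t , s≢t , pos , inj₁ τ≢
... | s , t , s≢t , pos , gaps-differ ≤d diff≢ = s , t , s≢t , pos , inj₂ (≤d , diff≢)

module TildeSeparation
  (δ : Pot) (u : Var) {N M : ℕ} (α : Var → Fin (suc N)) (β : Var → Fin (suc M)) where

  I J : Interp
  I = N , α
  J = M , β

  δᵤ : Term → ℕ
  δᵤ t = δ ⟨ var u , t ⟩

  Apartᵗ Alikeᵗ : Term → Term → Set
  Apartᵗ s t = Apart (tilde δ u ⟨ s , t ⟩) (val I s) (val I t) (val J s) (val J t)
  Alikeᵗ s t = Alike (tilde δ u ⟨ s , t ⟩) (val I s) (val I t) (val J s) (val J t)

  apart-or-alike-off-u : ∀ s t → (s ≢ var u × t ≢ var u × Apartᵗ s t)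
                                ⊎ (s ≢ var u → t ≢ var u → Alikeᵗ s t)
  apart-or-alike-off-u s t
    with s ≟var u | t ≟var u
       | apart-or-alike (tilde δ u ⟨ s , t ⟩) (val I s) (val I t) (val J s) (val J t)
  ... | _       | _       | inj₂ alike = inj₂ λ _ _ → alike
  ... | no s≢u  | no t≢u  | inj₁ apart = inj₁ (s≢u , t≢u , apart)
  ... | yes s≡u | _       | inj₁ _     = inj₂ λ s≢u _ → contradiction s≡u s≢u
  ... | no _    | yes t≡u | inj₁ _     = inj₂ λ _ t≢u → contradiction t≡u t≢u

  separates-by-apart-pair : ∀ {s t} → s ≢ var u → t ≢ var u → Apartᵗ s t →
                            Separates (tilde δ u) I J
  separates-by-apart-pair {s} {t} s≢u t≢u apart =
    s , t , s≢t , ≤-trans (m≤n+m 1 _) (tilde-≥-detour δ s≢u t≢u) , apart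
    where
    s≢t : s ≢ t
    s≢t refl = apart-irrefl _ _ apart

  separates-from-child : (a : Fin (suc N)) (b : Fin (suc M)) →
    (∀ {t} → t ≢ var u → Alike (δᵤ t) (toℕ a) (val I t) (toℕ b) (val J t)) →
    Separates δ (upd I u a) (upd J u b) → Separates (tilde δ u) I J
  separates-from-child a b extends (s , t , s≢t , pos , apart) with s ≟var u | t ≟var u
  ... | yes refl | yes refl = contradiction refl s≢t
  ... | yes refl | no t≢u   = contradiction
    (apart-cong (val-upd-var I u a) (val-upd-≢ I a t t≢u)
                (val-upd-var J u b) (val-upd-≢ J b t t≢u) apart)
    (alike⇒¬apart (extends t≢u))
  ... | no s≢u   | yes refl = contradiction
    (apart-cong (val-upd-≢ I a s s≢u) (val-upd-var I u a)
                (val-upd-≢ J b s s≢u) (val-upd-var J u b) apart)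
    (alike⇒¬apart (alike-mono (≤-reflexive (⟨⟩-comm δ s (var u))) (alike-flip (extends s≢u))))
  ... | no s≢u   | no t≢u   =
    s , t , s≢t , ≤-trans pos (tilde-≥-δ δ s≢u t≢u) , apart-mono (tilde-≥-δ δ s≢u t≢u)
      (apart-cong (val-upd-≢ I a s s≢u) (val-upd-≢ I a t t≢u)
                  (val-upd-≢ J b s s≢u) (val-upd-≢ J b t t≢u) apart)

  separates : (a : Fin (suc N)) → (∀ b → Separates δ (upd I u a) (upd J u b)) →
              Separates (tilde δ u) I J
  separates a child with some-or-all² apart-or-alike-off-u
  ... | inj₁ (_ , _ , s≢u , t≢u , apart) = separates-by-apart-pair s≢u t≢u apart
  ... | inj₂ alike =
    let b , extends = extension-fin (toℕ≤pred[n] a) in separates-from-child a b extends (child b)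
    where
    pairwise : ∀ {s t} → s ≢ var u → t ≢ var u →
               Alike (δᵤ s + δᵤ t + 1) (val I s) (val I t) (val J s) (val J t)
    pairwise s≢u t≢u = alike-mono (tilde-≥-detour δ s≢u t≢u) (alike _ _ s≢u t≢u)
    open Extension u δᵤ α β pairwise (toℕ a) using (extension-fin)

tilde-separates : (δ : Pot) (u : Var) (I J : Interp) (a : Fin (suc (proj₁ I))) →
                  (∀ b → Separates δ (upd I u a) (upd J u b)) → Separates (tilde δ u) I J
tilde-separates δ u (_ , α) (_ , β) = TildeSeparation.separates δ u α β

lemma3p12 : (ψ : Formula) (A B : ISet) → A ⊨ ψ → B ⊨ negF ψ →
            (T : EST A B ψ) →
            {A' B' : ISet} (Q : Quant) (u : Var) (φ₁ : Formula)
            (v : EST A' B' (quant Q u φ₁)) → Sub v T →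
            (δ₁ : Pot) →
            Separator δ₁ (proj₁ (childIL Q u φ₁ v)) (proj₂ (childIL Q u φ₁ v)) →
            Separator (tilde δ₁ u) A' B'
lemma3p12 _ _ _ _ _ _ ∃Q u _ (estEx ch _ _) _ δ₁ sep = toSeparator λ I J I∈A J∈B →
  tilde-separates δ₁ u I J (ch I) λ b →
    fromSeparator sep (I , I∈A , refl) (J , J∈B , b , refl)
lemma3p12 _ _ _ _ _ _ ∀Q u _ (estAll ch _ _) _ δ₁ sep = toSeparator λ I J I∈A J∈B →
  separates-sym (tilde-separates δ₁ u J I (ch J) λ a →
    separates-sym (fromSeparator sep (I , I∈A , a , refl) (J , J∈B , refl)))
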